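{- $\mathrm{scc}(K_t(2))\sim t\log t$ as $t\to\infty$, i.e. $\mathrm{scc}(K_t(2))/(t\log_2 t)\to 1$.
   Context: Here $\log$ denotes the logarithm to base $2$. The cocktail party graph $K_t(2)$ is obtained from the complete graph on vertex set $\{x_1,\dots,x_t\}\cup\{y_1,\dots,y_t\}$ by deleting the $t$ edges $x_iy_i$, $1\le i\le t$. A clique of a graph $G$ is a set of pairwise adjacent vertices; a clique covering of $G$ is a family of cliques such that every edge of $G$ lies in at least one of them. $\mathrm{scc}(G)$ is the minimum of $\sum_{C\in\mathcal{C}}|C|$ over all clique coverings $\mathcal{C}$ of $G$. -}

module Defs where

open import Data.Nat using (ℕ; _+_; _*_; _∸_; _^_; _≤_)
open import Data.Fin using (Fin)
open import Data.Bool using (Bool)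
open import Data.Product using (_×_; Σ; _,_; proj₁)
open import Data.List using (List; length; map)
open import Data.Nat.ListAction using (sum)
open import Data.List.Membership.Propositional using (_∈_)
open import Data.List.Relation.Unary.Any using (Any)
open import Data.List.Relation.Unary.AllPairs using (AllPairs)
open import Relation.Binary.PropositionalEquality using (_≡_; _≢_)

-- Vertices of the cocktail party graph K_t(2): (i , false) is x_i, (i , true) is y_i.
V : ℕ → Set
V t = Fin t × Bool

-- Adjacency in K_t(2): two vertices are adjacent iff their indices differ
-- (this is the complete graph minus the edges x_i y_i, and without loops).
Adj : (t : ℕ) → V t → V t → Set
Adj t (i , _) (j , _) = i ≢ j

-- A clique: a duplicate-free list of pairwise adjacent vertices
-- (pairwise adjacency already forces distinctness since Adj is irreflexive).
IsClique : (t : ℕ) → List (V t) → Set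
IsClique t C = AllPairs (Adj t) C

Clique : ℕ → Set
Clique t = Σ (List (V t)) (IsClique t)

IsCovering : (t : ℕ) → List (Clique t) → Set
IsCovering t 𝒞 = (u v : V t) → Adj t u v →
  Any (λ C → (u ∈ proj₁ C) × (v ∈ proj₁ C)) 𝒞

weight : {t : ℕ} → List (Clique t) → ℕ
weight 𝒞 = sum (map (λ C → length (proj₁ C)) 𝒞)

IsSCC : ℕ → ℕ → Set
IsSCC t n = Σ (List (Clique t)) (λ 𝒞 → IsCovering t 𝒞 × (weight 𝒞 ≡ n))
          × ((𝒞 : List (Clique t)) → IsCovering t 𝒞 → n ≤ weight 𝒞)

-- For naturals a, t and p, q ≥ 1:  a ≤ (p/q)·t·log₂ t  ⟺  2^(q·a) ≤ t^(p·t),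
-- and (p/q)·t·log₂ t ≤ a ⟺ t^(p·t) ≤ 2^(q·a). These exact integer encodings avoid reals.

-- Lower bound: for a clique covering 𝒞 of K_t(2) let dᵢ count the vertices of {xᵢ , yᵢ} over
-- all cliques, so weight 𝒞 = Σᵢ dᵢ. The edges xᵢyⱼ and xⱼyᵢ are covered, so the sets of cliques
-- meeting the pairs form a separating system and Kraft's inequality gives Σᵢ 2^(−eᵢ) ≤ 1, where
-- eᵢ ≤ dᵢ is the number of cliques meeting {xᵢ , yᵢ}. Bounding each dᵢ below by the tangent of
-- 2^(−d) at d = m yields weight 𝒞 ≥ (m + 1)(t − 2^m) for every m, and m ≈ log₂ t − k gives the
-- lower estimate.
--
-- Upper bound: choosing one vertex (i , f i) from every pair, for f : Fin t → Bool, gives a clique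
-- of size t. The choices for the two constant functions and for a family realising f i = true,
-- f j = false for all i ≠ j cover K_t(2). Such a family consists of the r ≈ log₂ t digits of a binary
-- code of i, plus the s ≈ log₂ log₂ t digits of the binary code of the number of ones of that code
-- and their complements: distinct codes are either incomparable or of different sizes.
-- This gives scc ≤ (2 + r + 2s) t.

module Submission where

open import Defs
open import Data.Nat using (ℕ; zero; suc; _+_; _*_; _∸_; _^_; _≤_; _<_; z≤n; s≤s; _<?_; _≤?_)
open import Data.Nat.Properties
open import Data.Nat.Induction using (<-rec)
open import Data.Nat.ListAction using (sum; product)
open import Data.Nat.Tactic.RingSolver using (solve-∀)
open import Data.Fin using (Fin; zero; suc; toℕ; inject≤; fromℕ<; finToFun; funToFin; combine)
  renaming (_≟_ to _≟ᶠ_)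
import Data.Fin.Properties as Finₚ
open import Data.Fin.Subset using (Subset; _⊆_; ∣_∣) renaming (_∈_ to _∈ₛ_; _∉_ to _∉ₛ_)
open import Data.Fin.Subset.Properties using (⊆-antisym; p⊂q⇒∣p∣<∣q∣; ∣p∣≤n) renaming (_∈?_ to _∈ₛ?_)
open import Data.Bool using (Bool; true; false; if_then_else_) renaming (_≟_ to _≟ᵇ_)
import Data.Vec as Vec
open import Data.Vec.Properties using (lookup∘tabulate)
open import Data.Product using (Σ; ∃; _×_; _,_; proj₁; proj₂)
open import Data.Product.Properties using (≡-dec)
open import Data.Sum using (_⊎_; inj₁; inj₂)
open import Data.Empty using (⊥-elim)
open import Data.List
  using (List; []; _∷_; [_]; _++_; length; map; filter; tabulate; allFin; cartesianProduct; cartesianProductWith)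
open import Data.List.Properties using (map-tabulate; length-tabulate; length-map; length-++)
open import Data.List.Membership.Propositional using (_∈_)
open import Data.List.Membership.Propositional.Properties
  using (∈-allFin; ∈-tabulate⁺; ∈-cartesianProduct⁺; ∈-cartesianProductWith⁺)
open import Data.List.Relation.Unary.Any as Any using (Any; here; there; any?)
import Data.List.Relation.Unary.Any.Properties as Anyₚ
open import Data.List.Relation.Unary.All as All using (All; []; _∷_; all?)
open import Data.List.Relation.Unary.All.Properties using (all-filter)
open import Data.List.Relation.Unary.AllPairs using (AllPairs; []; _∷_; allPairs?)
import Data.List.Relation.Unary.AllPairs.Properties as AllPairsₚ
open import Relation.Binary.PropositionalEquality
  using (_≡_; _≢_; refl; sym; trans; cong; cong₂; module ≡-Reasoning)
open import Relation.Nullary using (¬_; Dec; yes; no; does; ¬?; _×-dec_; _→-dec_)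
open import Relation.Nullary.Decidable using (dec-true; dec-false; decidable-stable)
open import Relation.Unary using (Decidable)
open import Function using (_∘_; id; const)
open import Algebra.Properties.CommutativeSemigroup +-commutativeSemigroup
  using () renaming (interchange to +-interchange)
open import Algebra.Properties.CommutativeSemigroup *-commutativeSemigroup
  using (x∙yz≈y∙xz) renaming (interchange to *-interchange)

𝟙 : {A : Set} → Dec A → ℕ
𝟙 a? = if does a? then 1 else 0

∑ : {A : Set} → List A → (A → ℕ) → ℕ
∑ xs f = sum (map f xs)

syntax ∑ xs (λ x → e) = ∑[ x ∈ xs ] e

module _ {A : Set} where

  ∑-cong : ∀ {f g : A → ℕ} xs → (∀ x → f x ≡ g x) → ∑ xs f ≡ ∑ xs g
  ∑-cong []       f≗g = refl
  ∑-cong (x ∷ xs) f≗g = cong₂ _+_ (f≗g x) (∑-cong xs f≗g)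

  ∑-mono-≤ : ∀ {f g : A → ℕ} xs → (∀ x → f x ≤ g x) → ∑ xs f ≤ ∑ xs g
  ∑-mono-≤ []       f≤g = z≤n
  ∑-mono-≤ (x ∷ xs) f≤g = +-mono-≤ (f≤g x) (∑-mono-≤ xs f≤g)

  ∑-distrib-+ : ∀ xs (f g : A → ℕ) → ∑[ x ∈ xs ] (f x + g x) ≡ ∑ xs f + ∑ xs g
  ∑-distrib-+ []       f g = refl
  ∑-distrib-+ (x ∷ xs) f g =
    trans (cong (f x + g x +_) (∑-distrib-+ xs f g)) (+-interchange (f x) (g x) (∑ xs f) (∑ xs g))

  *-distribˡ-∑ : ∀ c xs (f : A → ℕ) → c * ∑ xs f ≡ ∑[ x ∈ xs ] (c * f x)
  *-distribˡ-∑ c []       f = *-zeroʳ c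
  *-distribˡ-∑ c (x ∷ xs) f = trans (*-distribˡ-+ c (f x) _) (cong (c * f x +_) (*-distribˡ-∑ c xs f))

  ∑-const : ∀ (xs : List A) c → ∑[ _ ∈ xs ] c ≡ length xs * c
  ∑-const []       c = refl
  ∑-const (x ∷ xs) c = cong (c +_) (∑-const xs c)

  ∑-filter : ∀ {P : A → Set} (P? : Decidable P) xs (f : A → ℕ) →
    ∑[ x ∈ xs ] (𝟙 (P? x) * f x) ≡ ∑ (filter P? xs) f
  ∑-filter P? []       f = refl
  ∑-filter P? (x ∷ xs) f with P? x
  ... | yes _ = cong₂ _+_ (+-identityʳ (f x)) (∑-filter P? xs f)
  ... | no  _ = ∑-filter P? xs f

∑-comm : {A B : Set} (xs : List A) (ys : List B) (f : A → B → ℕ) →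
  ∑[ x ∈ xs ] ∑[ y ∈ ys ] f x y ≡ ∑[ y ∈ ys ] ∑[ x ∈ xs ] f x y
∑-comm []       ys f = sym (trans (∑-const ys 0) (*-zeroʳ (length ys)))
∑-comm (x ∷ xs) ys f = trans (cong (∑ ys (f x) +_) (∑-comm xs ys f))
                             (sym (∑-distrib-+ ys (f x) (λ y → ∑[ x′ ∈ xs ] f x′ y)))

∑-allFin-suc : ∀ n (f : Fin (suc n) → ℕ) → ∑ (allFin (suc n)) f ≡ f zero + ∑[ i ∈ allFin n ] f (suc i)
∑-allFin-suc n f = cong (λ ys → f zero + sum ys)
  (trans (map-tabulate suc f) (sym (map-tabulate id (f ∘ suc))))

∑-allFin-𝟙≡ : ∀ {n} (j : Fin n) → ∑[ i ∈ allFin n ] 𝟙 (j ≟ᶠ i) ≡ 1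
∑-allFin-𝟙≡ {suc n} zero    = begin
  ∑[ i ∈ allFin (suc n) ] 𝟙 (zero ≟ᶠ i) ≡⟨ ∑-allFin-suc n (λ i → 𝟙 (zero ≟ᶠ i)) ⟩
  1 + ∑[ i ∈ allFin n ] 0 ≡⟨ cong suc (∑-const (allFin n) 0) ⟩
  1 + length (allFin n) * 0 ≡⟨ cong suc (*-zeroʳ (length (allFin n))) ⟩
  1 ∎
  where open ≡-Reasoning
∑-allFin-𝟙≡ {suc n} (suc j) = trans (∑-allFin-suc n (λ i → 𝟙 (suc j ≟ᶠ i))) (∑-allFin-𝟙≡ j)

∑-∈-≤ : {A : Set} {x : A} {xs : List A} (f : A → ℕ) → x ∈ xs → f x ≤ ∑ xs f
∑-∈-≤ f (here refl) = m≤m+n _ _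
∑-∈-≤ {xs = y ∷ _} f (there x∈) = ≤-trans (∑-∈-≤ f x∈) (m≤n+m _ (f y))

filter-AllPairs : {A : Set} {P : A → Set} (P? : Decidable P) {R S : A → A → Set} →
  (∀ {x y} → P x → P y → R x y → S x y) → ∀ {xs} → AllPairs R xs → AllPairs S (filter P? xs)
filter-AllPairs {A} {P} P? {R} {S} R⇒S {xs} rs = weaken (all-filter P? xs) (AllPairsₚ.filter⁺ P? rs)
  where
  weaken : ∀ {ys} → All P ys → AllPairs R ys → AllPairs S ys
  weaken []         []         = []
  weaken (px ∷ pys) (rx ∷ rxs) = All.zipWith (λ (py , r) → R⇒S px py r) (pys , rx) ∷ weaken pys rxs

-- The lower bound: Kraft's inequality for clique coverings

_≟ⱽ_ : ∀ {t} (u v : V t) → Dec (u ≡ v)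
_≟ⱽ_ = ≡-dec _≟ᶠ_ _≟ᵇ_

module _ {t : ℕ} where

  open import Data.List.Membership.DecPropositional (_≟ⱽ_ {t}) using (_∈?_; _∉?_)

  Covers : List (Clique t) → V t → V t → Set
  Covers 𝒞 u v = Any (λ C → u ∈ proj₁ C × v ∈ proj₁ C) 𝒞

  covers-drop : ∀ {C 𝒞 u v} → ¬ (u ∈ proj₁ C × v ∈ proj₁ C) → Covers (C ∷ 𝒞) u v → Covers 𝒞 u v
  covers-drop uv∉C (here uv∈C) = ⊥-elim (uv∉C uv∈C)
  covers-drop uv∉C (there cov) = cov

  Separates : List (Clique t) → Fin t → Fin t → Set
  Separates 𝒞 i j = Covers 𝒞 (i , false) (j , true) × Covers 𝒞 (j , false) (i , true)

  separates-drop : ∀ {C 𝒞 i j} b → ¬ (i , b) ∈ proj₁ C → ¬ (j , b) ∈ proj₁ C →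
    Separates (C ∷ 𝒞) i j → Separates 𝒞 i j
  separates-drop true  i∉C j∉C (c₁ , c₂) = covers-drop (j∉C ∘ proj₂) c₁ , covers-drop (i∉C ∘ proj₂) c₂
  separates-drop false i∉C j∉C (c₁ , c₂) = covers-drop (i∉C ∘ proj₁) c₁ , covers-drop (j∉C ∘ proj₁) c₂

  absentCopies : Fin t → Clique t → ℕ
  absentCopies i C = 𝟙 ((i , true) ∉? proj₁ C) + 𝟙 ((i , false) ∉? proj₁ C)

  -- For a clique C, absentCopies i C is 1 or 2 according as C meets {xᵢ , yᵢ} or not, so
  -- kraftTerm i 𝒞 is 2 ^ (length 𝒞 − number of cliques meeting {xᵢ , yᵢ}).
  kraftTerm : Fin t → List (Clique t) → ℕ
  kraftTerm i 𝒞 = product (map (absentCopies i) 𝒞)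

  kraft : ∀ 𝒞 S → AllPairs (Separates 𝒞) S → ∑[ i ∈ S ] kraftTerm i 𝒞 ≤ 2 ^ length 𝒞
  kraft [] []          _                    = z≤n
  kraft [] (_ ∷ [])    _                    = ≤-refl
  kraft [] (_ ∷ _ ∷ _) (((() , _) ∷ _) ∷ _)
  kraft (C ∷ 𝒞) S sep = begin
    ∑[ i ∈ S ] (absentCopies i C * K i)
      ≡⟨ ∑-cong S (λ i → *-distribʳ-+ (K i) (𝟙 (y∉C i)) (𝟙 (x∉C i))) ⟩
    ∑[ i ∈ S ] (𝟙 (y∉C i) * K i + 𝟙 (x∉C i) * K i)
      ≡⟨ ∑-distrib-+ S _ _ ⟩
    ∑[ i ∈ S ] (𝟙 (y∉C i) * K i) + ∑[ i ∈ S ] (𝟙 (x∉C i) * K i)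
      ≡⟨ cong₂ _+_ (∑-filter y∉C S K) (∑-filter x∉C S K) ⟩
    ∑ (filter y∉C S) K + ∑ (filter x∉C S) K
      ≤⟨ +-mono-≤ (kraft 𝒞 _ (filter-AllPairs y∉C (separates-drop true) sep))
                  (kraft 𝒞 _ (filter-AllPairs x∉C (separates-drop false) sep)) ⟩
    2 ^ length 𝒞 + 2 ^ length 𝒞
      ≡⟨ cong (2 ^ length 𝒞 +_) (+-identityʳ (2 ^ length 𝒞)) ⟨
    2 ^ length (C ∷ 𝒞) ∎
    where
    open ≤-Reasoning
    K : Fin t → ℕ
    K i = kraftTerm i 𝒞
    y∉C : Decidable (λ i → ¬ (i , true) ∈ proj₁ C)
    y∉C i = (i , true) ∉? proj₁ C
    x∉C : Decidable (λ i → ¬ (i , false) ∈ proj₁ C)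
    x∉C i = (i , false) ∉? proj₁ C

  multiplicity : Fin t → Clique t → ℕ
  multiplicity i C = ∑[ v ∈ proj₁ C ] 𝟙 (proj₁ v ≟ᶠ i)

  load : Fin t → List (Clique t) → ℕ
  load i 𝒞 = ∑[ C ∈ 𝒞 ] multiplicity i C

  ∑-multiplicity≡length : ∀ C → ∑[ i ∈ allFin t ] multiplicity i C ≡ length (proj₁ C)
  ∑-multiplicity≡length (c , _) = begin
    ∑[ i ∈ allFin t ] ∑[ v ∈ c ] 𝟙 (proj₁ v ≟ᶠ i) ≡⟨ ∑-comm (allFin t) c _ ⟩
    ∑[ v ∈ c ] ∑[ i ∈ allFin t ] 𝟙 (proj₁ v ≟ᶠ i) ≡⟨ ∑-cong c (∑-allFin-𝟙≡ ∘ proj₁) ⟩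
    ∑[ v ∈ c ] 1                                 ≡⟨ ∑-const c 1 ⟩
    length c * 1                                 ≡⟨ *-identityʳ (length c) ⟩
    length c                                     ∎
    where open ≡-Reasoning

  ∑-load≡weight : ∀ 𝒞 → ∑[ i ∈ allFin t ] load i 𝒞 ≡ weight 𝒞
  ∑-load≡weight 𝒞 = trans (∑-comm (allFin t) 𝒞 multiplicity) (∑-cong 𝒞 ∑-multiplicity≡length)

  1≤multiplicity : ∀ {i b} C → (i , b) ∈ proj₁ C → 1 ≤ multiplicity i C
  1≤multiplicity {i} C v∈C = ≤-trans (≤-reflexive (sym i≟i≡1)) (∑-∈-≤ (λ v → 𝟙 (proj₁ v ≟ᶠ i)) v∈C)
    where
    i≟i≡1 : 𝟙 (i ≟ᶠ i) ≡ 1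
    i≟i≡1 rewrite dec-true (i ≟ᶠ i) refl = refl

  clique-index-injective : ∀ {c u v} → IsClique t c → u ∈ c → v ∈ c → proj₁ u ≡ proj₁ v → u ≡ v
  clique-index-injective _          (here refl) (here refl) _  = refl
  clique-index-injective (adj ∷ _)  (here refl) (there v∈c) eq = ⊥-elim (All.lookup adj v∈c eq)
  clique-index-injective (adj ∷ _)  (there u∈c) (here refl) eq = ⊥-elim (All.lookup adj u∈c (sym eq))
  clique-index-injective (_ ∷ cliq) (there u∈c) (there v∈c) eq = clique-index-injective cliq u∈c v∈c eq

  2≤absentCopies*2^multiplicityiplicity : ∀ i C → 2 ≤ absentCopies i C * 2 ^ multiplicity i C
  2≤absentCopies*2^multiplicityiplicity i C@(c , cliq) with (i , true) ∈? c | (i , false) ∈? c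
  ... | yes y∈c | yes x∈c = ⊥-elim (true≢false (cong proj₂ (clique-index-injective cliq y∈c x∈c refl)))
    where
    true≢false : true ≢ false
    true≢false ()
  ... | yes y∈c | no _    = ≤-trans (^-monoʳ-≤ 2 (1≤multiplicity C y∈c)) (m≤m+n _ 0)
  ... | no _    | yes x∈c = ≤-trans (^-monoʳ-≤ 2 (1≤multiplicity C x∈c)) (m≤m+n _ 0)
  ... | no _    | no _    = *-monoʳ-≤ 2 (m^n>0 2 (multiplicity i C))

  2^length≤kraftTerm*2^load : ∀ i 𝒞 → 2 ^ length 𝒞 ≤ kraftTerm i 𝒞 * 2 ^ load i 𝒞
  2^length≤kraftTerm*2^load i []      = ≤-refl
  2^length≤kraftTerm*2^load i (C ∷ 𝒞) = begin
    2 * 2 ^ length 𝒞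
      ≤⟨ *-mono-≤ (2≤absentCopies*2^multiplicityiplicity i C) (2^length≤kraftTerm*2^load i 𝒞) ⟩
    (absentCopies i C * 2 ^ multiplicity i C) * (kraftTerm i 𝒞 * 2 ^ load i 𝒞)
      ≡⟨ *-interchange (absentCopies i C) _ _ _ ⟩
    (absentCopies i C * kraftTerm i 𝒞) * (2 ^ multiplicity i C * 2 ^ load i 𝒞)
      ≡⟨ cong (absentCopies i C * kraftTerm i 𝒞 *_) (^-distribˡ-+-* 2 (multiplicity i C) (load i 𝒞)) ⟨
    kraftTerm i (C ∷ 𝒞) * 2 ^ load i (C ∷ 𝒞) ∎
    where open ≤-Reasoning

  separates-all : ∀ {𝒞} → IsCovering t 𝒞 → AllPairs (Separates 𝒞) (allFin t)
  separates-all cov = AllPairsₚ.tabulate⁺ {f = id}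
    (λ i≢j → cov _ _ i≢j , cov _ _ (i≢j ∘ sym))

-- The tangent-line bound (m+1)(1 − 2^(m−d)) ≤ d, scaled by 2^N, with e standing for 2^(N−d).
convexity : ∀ m N d e → 2 ^ N ≤ e * 2 ^ d → 2 ^ N * suc m ≤ 2 ^ N * d + suc m * 2 ^ m * e
convexity m N d e 2^N≤e*2^d with m <? d
... | yes m<d = ≤-trans (*-monoʳ-≤ (2 ^ N) m<d) (m≤m+n _ _)
... | no  m≮d = ≤-trans (*-monoˡ-≤ (suc m) 2^N≤e2^m) (≤-trans (≤-reflexive (rearrange (suc m) (2 ^ m) e)) (m≤n+m _ _))
  where
  2^N≤e2^m : 2 ^ N ≤ e * 2 ^ m
  2^N≤e2^m = ≤-trans 2^N≤e*2^d (*-monoʳ-≤ e (^-monoʳ-≤ 2 (≮⇒≥ m≮d)))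
  rearrange : ∀ a b c → c * b * a ≡ a * b * c
  rearrange = solve-∀

weight-lowerBound : ∀ {t} (𝒞 : List (Clique t)) → IsCovering t 𝒞 →
  ∀ m → t * suc m ≤ weight 𝒞 + suc m * 2 ^ m
weight-lowerBound {t} 𝒞 cov m = *-cancelˡ-≤ (2 ^ N) {{m^n≢0 2 N}} (begin
  2 ^ N * (t * suc m)
    ≡⟨ x∙yz≈y∙xz (2 ^ N) t (suc m) ⟩
  t * (2 ^ N * suc m)
    ≡⟨ cong (_* (2 ^ N * suc m)) (length-tabulate {n = t} id) ⟨
  length (allFin t) * (2 ^ N * suc m)
    ≡⟨ ∑-const (allFin t) (2 ^ N * suc m) ⟨
  ∑[ i ∈ allFin t ] (2 ^ N * suc m)
    ≤⟨ ∑-mono-≤ (allFin t) (λ i → convexity m N (load i 𝒞) (kraftTerm i 𝒞) (2^length≤kraftTerm*2^load i 𝒞)) ⟩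
  ∑[ i ∈ allFin t ] (2 ^ N * load i 𝒞 + suc m * 2 ^ m * kraftTerm i 𝒞)
    ≡⟨ ∑-distrib-+ (allFin t) _ _ ⟩
  ∑[ i ∈ allFin t ] (2 ^ N * load i 𝒞) + ∑[ i ∈ allFin t ] (suc m * 2 ^ m * kraftTerm i 𝒞)
    ≡⟨ cong₂ _+_ (*-distribˡ-∑ (2 ^ N) (allFin t) _) (*-distribˡ-∑ (suc m * 2 ^ m) (allFin t) _) ⟨
  2 ^ N * ∑[ i ∈ allFin t ] load i 𝒞 + suc m * 2 ^ m * ∑[ i ∈ allFin t ] kraftTerm i 𝒞
    ≤⟨ +-mono-≤ (≤-reflexive (cong (2 ^ N *_) (∑-load≡weight 𝒞)))
                (*-monoʳ-≤ (suc m * 2 ^ m) (kraft 𝒞 (allFin t) (separates-all cov))) ⟩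
  2 ^ N * weight 𝒞 + suc m * 2 ^ m * 2 ^ N
    ≡⟨ cong (2 ^ N * weight 𝒞 +_) (*-comm (suc m * 2 ^ m) (2 ^ N)) ⟩
  2 ^ N * weight 𝒞 + 2 ^ N * (suc m * 2 ^ m)
    ≡⟨ *-distribˡ-+ (2 ^ N) (weight 𝒞) (suc m * 2 ^ m) ⟨
  2 ^ N * (weight 𝒞 + suc m * 2 ^ m) ∎)
  where
  open ≤-Reasoning
  N = length 𝒞

-- The upper bound: coverings by transversals

bit : Fin 2 → Bool
bit zero       = false
bit (suc zero) = true

bit-injective : ∀ {a b} → bit a ≡ bit b → a ≡ b
bit-injective {zero}     {zero}     _ = refl
bit-injective {suc zero} {suc zero} _ = refl
bit-injective {zero}     {suc zero} ()
bit-injective {suc zero} {zero}     ()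

funToFin-cong : ∀ {m n} {f g : Fin m → Fin n} → (∀ i → f i ≡ g i) → funToFin f ≡ funToFin g
funToFin-cong {zero}  _   = refl
funToFin-cong {suc m} f≗g = cong₂ combine (f≗g zero) (funToFin-cong (f≗g ∘ suc))

binaryCode : ∀ {n} → Fin (2 ^ n) → Subset n
binaryCode {n} i = Vec.tabulate (bit ∘ finToFun {2} {n} i)

binaryCode-injective : ∀ {n} {i j : Fin (2 ^ n)} → binaryCode i ≡ binaryCode j → i ≡ j
binaryCode-injective {n} {i} {j} eq = begin
  i                                      ≡⟨ Finₚ.funToFin-finToFin {n} {2} i ⟨
  funToFin {n} {2} (finToFun {2} {n} i)  ≡⟨ funToFin-cong (λ p → bit-injective (digit p)) ⟩
  funToFin {n} {2} (finToFun {2} {n} j)  ≡⟨ Finₚ.funToFin-finToFin {n} {2} j ⟩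
  j                                      ∎
  where
  open ≡-Reasoning
  digit : ∀ p → bit (finToFun {2} {n} i p) ≡ bit (finToFun {2} {n} j p)
  digit p = trans (sym (lookup∘tabulate (bit ∘ finToFun {2} {n} i) p)) (trans (cong (λ v → Vec.lookup v p) eq) (lookup∘tabulate _ p))

witness-or-⊆ : ∀ {n} (u v : Subset n) → (∃ λ x → x ∈ₛ u × x ∉ₛ v) ⊎ u ⊆ v
witness-or-⊆ u v with Finₚ.any? (λ x → x ∈ₛ? u ×-dec ¬? (x ∈ₛ? v))
... | yes w = inj₁ w
... | no ∄w = inj₂ (λ {x} x∈u → decidable-stable (x ∈ₛ? v) (λ x∉v → ∄w (x , x∈u , x∉v)))

≢-witness : ∀ {n} {u v : Subset n} → u ≢ v → (∃ λ x → x ∈ₛ u × x ∉ₛ v) ⊎ (∃ λ x → x ∈ₛ v × x ∉ₛ u)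
≢-witness {u = u} {v} u≢v with witness-or-⊆ u v | witness-or-⊆ v u
... | inj₁ w   | _        = inj₁ w
... | inj₂ _   | inj₁ w   = inj₂ w
... | inj₂ u⊆v | inj₂ v⊆u = ⊥-elim (u≢v (⊆-antisym u⊆v v⊆u))

≢-witness-or-∣<∣ : ∀ {n} {u v : Subset n} → u ≢ v → (∃ λ x → x ∈ₛ u × x ∉ₛ v) ⊎ ∣ u ∣ < ∣ v ∣
≢-witness-or-∣<∣ {u = u} {v} u≢v with witness-or-⊆ u v | ≢-witness u≢v
... | inj₁ w   | _                    = inj₁ w
... | inj₂ u⊆v | inj₁ (x , x∈u , x∉v) = ⊥-elim (x∉v (u⊆v x∈u))
... | inj₂ u⊆v | inj₂ (x , x∈v , x∉u) = inj₂ (p⊂q⇒∣p∣<∣q∣ (u⊆v , x , x∈v , x∉u))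

module _ {t : ℕ} where

  transversal : (Fin t → Bool) → Clique t
  transversal f = tabulate (λ i → i , f i) , AllPairsₚ.tabulate⁺ id

  weight-transversals : ∀ fs → weight (map transversal fs) ≡ length fs * t
  weight-transversals []       = refl
  weight-transversals (f ∷ fs) = cong₂ _+_ (length-tabulate (λ i → i , f i)) (weight-transversals fs)

  Distinguishes : List (Fin t → Bool) → Set
  Distinguishes fs = ∀ {i j} → i ≢ j → Any (λ f → f i ≡ true × f j ≡ false) fs

  transversals-cover : ∀ fs → Distinguishes fs →
    IsCovering t (map transversal (const false ∷ const true ∷ fs))
  transversals-cover fs dist (i , a) (j , b) i≢j = Anyₚ.map⁺ (Any.map realise (patterns a b))
    where
    patterns : ∀ a b → Any (λ f → f i ≡ a × f j ≡ b) (const false ∷ const true ∷ fs)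
    patterns false false = here (refl , refl)
    patterns true  true  = there (here (refl , refl))
    patterns true  false = there (there (dist i≢j))
    patterns false true  = there (there (Any.map (λ (fj , fi) → fi , fj) (dist (i≢j ∘ sym))))
    realise : ∀ {f} → f i ≡ a × f j ≡ b →
      (i , a) ∈ proj₁ (transversal f) × (j , b) ∈ proj₁ (transversal f)
    realise {f} (refl , refl) = ∈-tabulate⁺ i , ∈-tabulate⁺ j

  memberships : ∀ {n} → (Fin t → Subset n) → List (Fin t → Bool)
  memberships {n} code = map (λ x i → does (x ∈ₛ? code i)) (allFin n)

  nonMemberships : ∀ {n} → (Fin t → Subset n) → List (Fin t → Bool)
  nonMemberships {n} code = map (λ x i → does (¬? (x ∈ₛ? code i))) (allFin n)

  memberships-distinguish : ∀ {n} (code : Fin t → Subset n) {i j x} → x ∈ₛ code i → x ∉ₛ code j →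
    Any (λ f → f i ≡ true × f j ≡ false) (memberships code)
  memberships-distinguish code {i} {j} {x} x∈i x∉j =
    Anyₚ.map⁺ (Any.map (λ { refl → dec-true (x ∈ₛ? code i) x∈i , dec-false (x ∈ₛ? code j) x∉j }) (∈-allFin x))

  nonMemberships-distinguish : ∀ {n} (code : Fin t → Subset n) {i j x} → x ∉ₛ code i → x ∈ₛ code j →
    Any (λ f → f i ≡ true × f j ≡ false) (nonMemberships code)
  nonMemberships-distinguish code {i} {j} {x} x∉i x∈j =
    Anyₚ.map⁺ (Any.map (λ { refl → dec-true (¬? (x ∈ₛ? code i)) x∉i , dec-false (¬? (x ∈ₛ? code j)) (λ x∉j → x∉j x∈j) }) (∈-allFin x))

module SeparatingFamily {t r s : ℕ} (t≤2^r : t ≤ 2 ^ r) (r<2^s : r < 2 ^ s) where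

  code : Fin t → Subset r
  code i = binaryCode (inject≤ i t≤2^r)

  sizeCode : Fin t → Subset s
  sizeCode i = binaryCode (fromℕ< (≤-<-trans (∣p∣≤n (code i)) r<2^s))

  family : List (Fin t → Bool)
  family = memberships code ++ memberships sizeCode ++ nonMemberships sizeCode

  code-injective : ∀ {i j} → i ≢ j → code i ≢ code j
  code-injective i≢j = i≢j ∘ Finₚ.inject≤-injective _ _ _ _ ∘ binaryCode-injective

  sizeCode-injective : ∀ {i j} → ∣ code i ∣ ≢ ∣ code j ∣ → sizeCode i ≢ sizeCode j
  sizeCode-injective ∣i∣≢∣j∣ eq = ∣i∣≢∣j∣ (begin
    ∣ code _ ∣          ≡⟨ Finₚ.toℕ-fromℕ< _ ⟨
    toℕ (fromℕ< _)     ≡⟨ cong toℕ (binaryCode-injective eq) ⟩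
    toℕ (fromℕ< _)     ≡⟨ Finₚ.toℕ-fromℕ< _ ⟩
    ∣ code _ ∣          ∎)
    where open ≡-Reasoning

  -- A strict inclusion of codes changes their size, which sizeCode then detects in one direction or the other.
  family-distinguishes : Distinguishes family
  family-distinguishes i≢j with ≢-witness-or-∣<∣ (code-injective i≢j)
  ... | inj₁ (x , x∈i , x∉j) = Anyₚ.++⁺ˡ (memberships-distinguish code x∈i x∉j)
  ... | inj₂ ∣i∣<∣j∣ with ≢-witness (sizeCode-injective (<⇒≢ ∣i∣<∣j∣))
  ...   | inj₁ (x , x∈i , x∉j) =
    Anyₚ.++⁺ʳ (memberships code) (Anyₚ.++⁺ˡ (memberships-distinguish sizeCode x∈i x∉j))
  ...   | inj₂ (x , x∈j , x∉i) =
    Anyₚ.++⁺ʳ (memberships code) (Anyₚ.++⁺ʳ (memberships sizeCode) (nonMemberships-distinguish sizeCode x∉i x∈j))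

  length-family : length family ≡ r + (s + s)
  length-family = begin
    length family
      ≡⟨ length-++ (memberships code) ⟩
    length (memberships code) + length (memberships sizeCode ++ nonMemberships sizeCode)
      ≡⟨ cong (length (memberships code) +_) (length-++ (memberships sizeCode)) ⟩
    length (memberships code) + (length (memberships sizeCode) + length (nonMemberships sizeCode))
      ≡⟨ cong₂ _+_ (length-allFin-map r) (cong₂ _+_ (length-allFin-map s) (length-allFin-map s)) ⟩
    r + (s + s) ∎
    where
    open ≡-Reasoning
    length-allFin-map : ∀ n {f : Fin n → Fin t → Bool} → length (map f (allFin n)) ≡ n
    length-allFin-map n {f} = trans (length-map f (allFin n)) (length-tabulate id)

covering-of-weight : ∀ {t r s} → t ≤ 2 ^ r → r < 2 ^ s →
  Σ (List (Clique t)) (λ 𝒞 → IsCovering t 𝒞 × weight 𝒞 ≡ (2 + (r + (s + s))) * t)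
covering-of-weight {t} {r} {s} t≤2^r r<2^s =
  map transversal fs ,
  transversals-cover family family-distinguishes ,
  trans (weight-transversals fs) (cong (λ n → (2 + n) * t) length-family)
  where
  open SeparatingFamily {t} {r} {s} t≤2^r r<2^s
  fs = const false ∷ const true ∷ family

-- Existence of a minimum-weight covering

least-satisfying : {P : ℕ → Set} → Decidable P → ∀ n → P n →
  Σ ℕ (λ m → P m × (∀ j → P j → m ≤ j))
least-satisfying {P} P? = <-rec (λ n → P n → Least) search
  where
  Least = Σ ℕ (λ m → P m × (∀ j → P j → m ≤ j))
  search : ∀ n → (∀ {j} → j < n → P j → Least) → P n → Least
  search n rec Pn with anyUpTo? P? n
  ... | yes (j , j<n , Pj) = rec j<n Pj
  ... | no  ∄j             = n , Pn , λ j Pj → ≮⇒≥ (λ j<n → ∄j (j , j<n , Pj))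

module _ {A : Set} where

  boundedLists : List A → ℕ → List (List A)
  boundedLists xs zero    = [ [] ]
  boundedLists xs (suc m) = [] ∷ cartesianProductWith _∷_ xs (boundedLists xs m)

  ∈-boundedLists : ∀ {xs ys} m → All (_∈ xs) ys → length ys ≤ m → ys ∈ boundedLists xs m
  ∈-boundedLists zero    []         _         = here refl
  ∈-boundedLists (suc m) []         _         = here refl
  ∈-boundedLists (suc m) (y∈ ∷ ys∈) (s≤s len) = there (∈-cartesianProductWith⁺ _∷_ y∈ (∈-boundedLists m ys∈ len))

module _ {t : ℕ} where

  vertices : List (V t)
  vertices = cartesianProduct (allFin t) (false ∷ true ∷ [])

  ∈-vertices : ∀ v → v ∈ vertices
  ∈-vertices (i , b) = ∈-cartesianProduct⁺ (∈-allFin i) (∈-bools b)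
    where
    ∈-bools : ∀ b → b ∈ false ∷ true ∷ []
    ∈-bools false = here refl
    ∈-bools true  = there (here refl)

  open import Data.List.Membership.DecPropositional (_≟ⱽ_ {t}) using (_∈?_)

  CoversEdges : List (List (V t)) → Set
  CoversEdges L = ∀ u v → Adj t u v → Any (λ c → u ∈ c × v ∈ c) L

  coversEdges? : Decidable CoversEdges
  coversEdges? L with all? (λ u → all? (λ v → adj? u v →-dec covered? u v) vertices) vertices
    where
    adj? : ∀ u v → Dec (Adj t u v)
    adj? (i , _) (j , _) = ¬? (i ≟ᶠ j)
    covered? : ∀ u v → Dec (Any (λ c → u ∈ c × v ∈ c) L)
    covered? u v = any? (λ c → u ∈? c ×-dec v ∈? c) L
  ... | yes all = yes (λ u v → All.lookup (All.lookup all (∈-vertices u)) (∈-vertices v))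
  ... | no ¬all = no (λ cov → ¬all (All.tabulate (λ {u} _ → All.tabulate (λ {v} _ → cov u v))))

  CoveringWithin : ℕ → List (List (V t)) → Set
  CoveringWithin m L = All (IsClique t) L × CoversEdges L × ∑ L length ≤ m

  candidates : ℕ → List (List (List (V t)))
  candidates m = boundedLists (boundedLists vertices m) m

  -- Searching only the candidates loses nothing (see coverableWithin-intro) and makes the property decidable.
  CoverableWithin : ℕ → Set
  CoverableWithin m = Any (CoveringWithin m) (candidates m)

  coverableWithin? : Decidable CoverableWithin
  coverableWithin? m = any? coveringWithin? (candidates m)
    where
    coveringWithin? : Decidable (CoveringWithin m)
    coveringWithin? L =
      all? (allPairs? (λ u v → ¬? (proj₁ u ≟ᶠ proj₁ v))) L ×-dec coversEdges? L ×-dec ∑ L length ≤? m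

  nonEmptyLists : List (Clique t) → List (List (V t))
  nonEmptyLists []                = []
  nonEmptyLists (([] , _)    ∷ 𝒞) = nonEmptyLists 𝒞
  nonEmptyLists ((v ∷ c , _) ∷ 𝒞) = (v ∷ c) ∷ nonEmptyLists 𝒞

  nonEmptyLists-cliques : ∀ 𝒞 → All (IsClique t) (nonEmptyLists 𝒞)
  nonEmptyLists-cliques []                   = []
  nonEmptyLists-cliques (([] , _)    ∷ 𝒞)    = nonEmptyLists-cliques 𝒞
  nonEmptyLists-cliques ((v ∷ c , cl) ∷ 𝒞)   = cl ∷ nonEmptyLists-cliques 𝒞

  nonEmptyLists-covers : ∀ 𝒞 → IsCovering t 𝒞 → CoversEdges (nonEmptyLists 𝒞)
  nonEmptyLists-covers 𝒞 cov u v u~v = keep 𝒞 (cov u v u~v)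
    where
    keep : ∀ 𝒞 → Any (λ C → u ∈ proj₁ C × v ∈ proj₁ C) 𝒞 → Any (λ c → u ∈ c × v ∈ c) (nonEmptyLists 𝒞)
    keep (([] , _)    ∷ 𝒞) (here (() , _))
    keep (([] , _)    ∷ 𝒞) (there uv∈𝒞) = keep 𝒞 uv∈𝒞
    keep ((w ∷ c , _) ∷ 𝒞) (here uv∈C)  = here uv∈C
    keep ((w ∷ c , _) ∷ 𝒞) (there uv∈𝒞) = there (keep 𝒞 uv∈𝒞)

  ∑-nonEmptyLists : ∀ 𝒞 → ∑ (nonEmptyLists 𝒞) length ≡ weight 𝒞
  ∑-nonEmptyLists []                = refl
  ∑-nonEmptyLists (([] , _)    ∷ 𝒞) = ∑-nonEmptyLists 𝒞
  ∑-nonEmptyLists ((v ∷ c , _) ∷ 𝒞) = cong (suc (length c) +_) (∑-nonEmptyLists 𝒞)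

  length-nonEmptyLists : ∀ 𝒞 → length (nonEmptyLists 𝒞) ≤ weight 𝒞
  length-nonEmptyLists []                = z≤n
  length-nonEmptyLists (([] , _)    ∷ 𝒞) = length-nonEmptyLists 𝒞
  length-nonEmptyLists ((v ∷ c , _) ∷ 𝒞) = +-mono-≤ (s≤s z≤n) (length-nonEmptyLists 𝒞)

  coverableWithin-intro : ∀ {m} 𝒞 → IsCovering t 𝒞 → weight 𝒞 ≤ m → CoverableWithin m
  coverableWithin-intro {m} 𝒞 cov w≤m = Any.map (λ { refl → covering }) L∈candidates
    where
    L = nonEmptyLists 𝒞
    ∑≤m : ∑ L length ≤ m
    ∑≤m = ≤-trans (≤-reflexive (∑-nonEmptyLists 𝒞)) w≤m
    covering : CoveringWithin m L
    covering = nonEmptyLists-cliques 𝒞 , nonEmptyLists-covers 𝒞 cov , ∑≤m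
    L∈candidates : L ∈ candidates m
    L∈candidates = ∈-boundedLists m
      (All.tabulate (λ c∈L → ∈-boundedLists m (All.tabulate (λ {v} _ → ∈-vertices v)) (≤-trans (∑-∈-≤ length c∈L) ∑≤m)))
      (≤-trans (length-nonEmptyLists 𝒞) w≤m)

  weight-toList : ∀ {L} (cliques : All (IsClique t) L) → weight (All.toList cliques) ≡ ∑ L length
  weight-toList []                    = refl
  weight-toList {c ∷ _} (_ ∷ cliques) = cong (length c +_) (weight-toList cliques)

  toList-covers : ∀ {L} (cliques : All (IsClique t) L) → CoversEdges L → IsCovering t (All.toList cliques)
  toList-covers cliques cov u v u~v = lift cliques (cov u v u~v)
    where
    lift : ∀ {L} (cliques : All (IsClique t) L) →
      Any (λ c → u ∈ c × v ∈ c) L → Any (λ C → u ∈ proj₁ C × v ∈ proj₁ C) (All.toList cliques)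
    lift (_ ∷ _)       (here uv∈c)  = here uv∈c
    lift (_ ∷ cliques) (there uv∈L) = there (lift cliques uv∈L)

  coverableWithin-elim : ∀ {m} → CoverableWithin m →
    Σ (List (Clique t)) (λ 𝒞 → IsCovering t 𝒞 × weight 𝒞 ≤ m)
  coverableWithin-elim c with Any.satisfied c
  ... | L , cliques , covers , ∑≤m =
    All.toList cliques , toList-covers cliques covers , ≤-trans (≤-reflexive (weight-toList cliques)) ∑≤m

scc-exists : ∀ {t} (𝒞 : List (Clique t)) → IsCovering t 𝒞 → Σ ℕ (λ n → IsSCC t n × n ≤ weight 𝒞)
scc-exists {t} 𝒞 cov with least-satisfying coverableWithin? (weight 𝒞) (coverableWithin-intro 𝒞 cov ≤-refl)
... | n , coverable , minimal with coverableWithin-elim coverable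
...   | 𝒟 , cov𝒟 , w≤n = n , ((𝒟 , cov𝒟 , ≤-antisym w≤n (n≤weight 𝒟 cov𝒟)) , n≤weight) , n≤weight 𝒞 cov
  where
  n≤weight : ∀ 𝒞 → IsCovering t 𝒞 → n ≤ weight 𝒞
  n≤weight 𝒞 cov = minimal (weight 𝒞) (coverableWithin-intro 𝒞 cov ≤-refl)

-- Asymptotics

n<2^n : ∀ n → n < 2 ^ n
n<2^n zero    = s≤s z≤n
n<2^n (suc n) = +-mono-≤ (m^n>0 2 n) (≤-trans (n<2^n n) (m≤m+n (2 ^ n) 0))

log₂-bracket : ∀ t → 1 ≤ t → Σ ℕ (λ ℓ → 2 ^ ℓ ≤ t × t < 2 ^ suc ℓ)
log₂-bracket (suc zero)    _ = 0 , ≤-refl , s≤s (s≤s z≤n)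
log₂-bracket (suc (suc t)) _ with log₂-bracket (suc t) (s≤s z≤n)
... | ℓ , 2^ℓ≤ , <2^ℓ+1 with suc (suc t) <? 2 ^ suc ℓ
...   | yes t+2<2^ℓ+1 = ℓ , ≤-trans 2^ℓ≤ (n≤1+n _) , t+2<2^ℓ+1
...   | no  t+2≮2^ℓ+1 = suc ℓ , ≤-reflexive (sym t+2≡2^ℓ+1) , (begin-strict
  suc (suc t)         ≡⟨ t+2≡2^ℓ+1 ⟩
  2 ^ suc ℓ           <⟨ m<m+n (2 ^ suc ℓ) (m^n>0 2 (suc ℓ)) ⟩
  2 ^ suc ℓ + 2 ^ suc ℓ ≡⟨ cong (2 ^ suc ℓ +_) (+-identityʳ (2 ^ suc ℓ)) ⟨
  2 ^ suc (suc ℓ)     ∎)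
  where
  open ≤-Reasoning
  t+2≡2^ℓ+1 : suc (suc t) ≡ 2 ^ suc ℓ
  t+2≡2^ℓ+1 = ≤-antisym <2^ℓ+1 (≮⇒≥ t+2≮2^ℓ+1)

2^-bracket-≤ : ∀ {X t ℓ} → 2 ^ X ≤ t → t < 2 ^ suc ℓ → X ≤ ℓ
2^-bracket-≤ {X} {t} {ℓ} 2^X≤t t<2^ℓ+1 with X ≤? ℓ
... | yes X≤ℓ = X≤ℓ
... | no  X≰ℓ = ⊥-elim (<-irrefl refl (≤-trans t<2^ℓ+1 (≤-trans (^-monoʳ-≤ 2 (≰⇒> X≰ℓ)) 2^X≤t)))

slack-bound : ∀ K c m t P → 2 * K * c ≤ suc m → 2 * suc K ≤ 2 ^ c → 2 ^ c * P ≤ t →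
  K * c * t + suc K * suc m * P ≤ suc m * t
slack-bound K c m t P 2Kc≤m+1 2[K+1]≤2^c 2^cP≤t = *-cancelˡ-≤ (2 * Q) {{nonZero}} (begin
  2 * Q * (K * c * t + suc K * suc m * P)      ≡⟨ expand K c m t P Q ⟩
  2 * K * c * (Q * t) + 2 * suc K * (suc m * (Q * P))
    ≤⟨ +-mono-≤ (*-monoˡ-≤ (Q * t) 2Kc≤m+1) (*-mono-≤ 2[K+1]≤2^c (*-monoʳ-≤ (suc m) 2^cP≤t)) ⟩
  suc m * (Q * t) + Q * (suc m * t)            ≡⟨ collect m t Q ⟩
  2 * Q * (suc m * t)                          ∎)
  where
  open ≤-Reasoning
  Q = 2 ^ c
  nonZero = m*n≢0 2 Q {{_}} {{m^n≢0 2 c}}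
  expand : ∀ K c m t P Q → 2 * Q * (K * c * t + suc K * suc m * P) ≡ 2 * K * c * (Q * t) + 2 * suc K * (suc m * (Q * P))
  expand = solve-∀
  collect : ∀ m t Q → suc m * (Q * t) + Q * (suc m * t) ≡ 2 * Q * (suc m * t)
  collect = solve-∀

exponent-lowerBound : ∀ K c m t W P → K * c * t + suc K * suc m * P ≤ suc m * t →
  t * suc m ≤ W + suc m * P → suc (m + c) * (K * t) ≤ suc K * W
exponent-lowerBound K c m t W P slack tm≤W+mP = +-cancelʳ-≤ X _ _ (begin
  suc (m + c) * (K * t) + X            ≡⟨ split m c K t X ⟩
  K * suc m * t + (K * c * t + X)      ≤⟨ +-monoʳ-≤ (K * suc m * t) slack ⟩
  K * suc m * t + suc m * t            ≡⟨ merge K m t ⟩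
  suc K * (t * suc m)                  ≤⟨ *-monoʳ-≤ (suc K) tm≤W+mP ⟩
  suc K * (W + suc m * P)              ≡⟨ distribute K W m P ⟩
  suc K * W + X                        ∎)
  where
  open ≤-Reasoning
  X = suc K * suc m * P
  split : ∀ m c K t X → suc (m + c) * (K * t) + X ≡ K * suc m * t + (K * c * t + X)
  split = solve-∀
  merge : ∀ K m t → K * suc m * t + suc m * t ≡ suc K * (t * suc m)
  merge = solve-∀
  distribute : ∀ K W m P → suc K * (W + suc m * P) ≡ suc K * W + suc K * suc m * P
  distribute = solve-∀

lowerThreshold : ℕ → ℕ
lowerThreshold K = 2 + K + 2 * K * (2 + K)

-- Evaluates the bound at m = ⌊log₂ t⌋ − (K + 2); the threshold makes 2K(K + 2) ≤ m + 1.
power-lowerBound : ∀ K t W → 2 ^ lowerThreshold K ≤ t →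
  (∀ m → t * suc m ≤ W + suc m * 2 ^ m) → t ^ (K * t) ≤ 2 ^ (suc K * W)
power-lowerBound K t W threshold≤t bound with log₂-bracket t (≤-trans (m^n>0 2 (lowerThreshold K)) threshold≤t)
... | ℓ , 2^ℓ≤t , t<2^ℓ+1 = begin
  t ^ (K * t)                ≤⟨ ^-monoˡ-≤ (K * t) (<⇒≤ t<2^ℓ+1) ⟩
  (2 ^ suc ℓ) ^ (K * t)      ≡⟨ ^-*-assoc 2 (suc ℓ) (K * t) ⟩
  2 ^ (suc ℓ * (K * t))      ≡⟨ cong (λ x → 2 ^ (suc x * (K * t))) m+c≡ℓ ⟨
  2 ^ (suc (m + c) * (K * t)) ≤⟨ ^-monoʳ-≤ 2 (exponent-lowerBound K c m t W (2 ^ m) slack (bound m)) ⟩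
  2 ^ (suc K * W)            ∎
  where
  open ≤-Reasoning
  c = 2 + K
  threshold≤ℓ : lowerThreshold K ≤ ℓ
  threshold≤ℓ = 2^-bracket-≤ threshold≤t t<2^ℓ+1
  m = ℓ ∸ c
  m+c≡ℓ : m + c ≡ ℓ
  m+c≡ℓ = m∸n+n≡m (≤-trans (m≤m+n c _) threshold≤ℓ)
  2Kc≤m+1 : 2 * K * c ≤ suc m
  2Kc≤m+1 = ≤-trans (+-cancelˡ-≤ c _ _ (≤-trans threshold≤ℓ (≤-reflexive (trans (sym m+c≡ℓ) (+-comm m c))))) (n≤1+n m)
  2[K+1]≤2^c : 2 * suc K ≤ 2 ^ c
  2[K+1]≤2^c = *-monoʳ-≤ 2 (<⇒≤ (n<2^n (suc K)))
  2^c*2^m≤t : 2 ^ c * 2 ^ m ≤ t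
  2^c*2^m≤t = begin
    2 ^ c * 2 ^ m  ≡⟨ ^-distribˡ-+-* 2 c m ⟨
    2 ^ (c + m)    ≡⟨ cong (2 ^_) (trans (+-comm c m) m+c≡ℓ) ⟩
    2 ^ ℓ          ≤⟨ 2^ℓ≤t ⟩
    t              ∎
  slack : K * c * t + suc K * suc m * 2 ^ m ≤ suc m * t
  slack = slack-bound K c m t (2 ^ m) 2Kc≤m+1 2[K+1]≤2^c 2^c*2^m≤t

linearStart : ℕ → ℕ → ℕ
linearStart a b = suc (suc (2 * (a + b)))

linear≤2^ : ∀ a b j → a * (linearStart a b + j) + b ≤ 2 ^ (linearStart a b + j)
linear≤2^ a b zero = begin
  a * (x₀ + 0) + b             ≡⟨ cong (λ x → a * x + b) (+-identityʳ x₀) ⟩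
  a * x₀ + b                   ≤⟨ +-mono-≤ (*-monoˡ-≤ x₀ (m≤m+n a b)) (m≤n+m b a) ⟩
  n * x₀ + n                   ≤⟨ m≤m+n _ (2 * n * n + 5 * n + 4) ⟩
  n * x₀ + n + (2 * n * n + 5 * n + 4)   ≡⟨ square n ⟩
  (2 * suc n) * (2 * suc n)    ≤⟨ *-mono-≤ 2[n+1]≤2^[n+1] 2[n+1]≤2^[n+1] ⟩
  2 ^ suc n * 2 ^ suc n        ≡⟨ ^-distribˡ-+-* 2 (suc n) (suc n) ⟨
  2 ^ (suc n + suc n)          ≡⟨ cong (2 ^_) (x₀≡ n) ⟩
  2 ^ (x₀ + 0)                 ∎
  where
  open ≤-Reasoning
  n = a + b
  x₀ = linearStart a b
  2[n+1]≤2^[n+1] : 2 * suc n ≤ 2 ^ suc n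
  2[n+1]≤2^[n+1] = *-monoʳ-≤ 2 (n<2^n n)
  square : ∀ n → n * suc (suc (2 * n)) + n + (2 * n * n + 5 * n + 4) ≡ (2 * suc n) * (2 * suc n)
  square = solve-∀
  x₀≡ : ∀ n → suc n + suc n ≡ suc (suc (2 * n)) + 0
  x₀≡ = solve-∀
linear≤2^ a b (suc j) = begin
  a * (x₀ + suc j) + b             ≡⟨ shift a x₀ j b ⟩
  (a * (x₀ + j) + b) + a           ≤⟨ +-mono-≤ ih (≤-trans a≤ ih) ⟩
  2 ^ (x₀ + j) + 2 ^ (x₀ + j)      ≡⟨ cong (2 ^ (x₀ + j) +_) (+-identityʳ _) ⟨
  2 ^ suc (x₀ + j)                 ≡⟨ cong (2 ^_) (+-suc x₀ j) ⟨
  2 ^ (x₀ + suc j)                 ∎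
  where
  open ≤-Reasoning
  x₀ = linearStart a b
  ih = linear≤2^ a b j
  a≤ : a ≤ a * (x₀ + j) + b
  a≤ = ≤-trans (m≤m*n a (x₀ + j)) (m≤m+n _ b)
  shift : ∀ a x j b → a * (x + suc j) + b ≡ (a * (x + j) + b) + a
  shift = solve-∀

upperThreshold : ℕ → ℕ
upperThreshold K = 2 ^ (2 ^ linearStart (2 * K) (5 * K + 2))

-- Chooses r = ⌊log₂ t⌋ + 1 and s = ⌊log₂ (r + 1)⌋ + 1; the threshold makes K(2s + 3) ≤ r − 1.
power-upperBound : ∀ K t → upperThreshold K ≤ t →
  Σ ℕ (λ r → Σ ℕ (λ s → t ≤ 2 ^ r × r < 2 ^ s ×
    (∀ n → n ≤ (2 + (r + (s + s))) * t → 2 ^ (K * n) ≤ t ^ ((K + 1) * t))))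
power-upperBound K t threshold≤t with log₂-bracket t (≤-trans (m^n>0 2 (2 ^ linearStart (2 * K) (5 * K + 2))) threshold≤t)
... | ℓ , 2^ℓ≤t , t<2^ℓ+1 with log₂-bracket (2 + ℓ) (s≤s z≤n)
...   | σ , 2^σ≤ℓ+2 , ℓ+2<2^σ+1 = suc ℓ , suc σ , <⇒≤ t<2^ℓ+1 , <-trans (n<1+n (suc ℓ)) ℓ+2<2^σ+1 , bound
  where
  open ≤-Reasoning
  x₀ = linearStart (2 * K) (5 * K + 2)
  x₀≤σ : x₀ ≤ σ
  x₀≤σ = 2^-bracket-≤ (≤-trans (2^-bracket-≤ threshold≤t t<2^ℓ+1) (m≤n+m ℓ 2)) ℓ+2<2^σ+1
  K[2σ+5]≤ℓ : K * (2 * σ + 5) ≤ ℓ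
  K[2σ+5]≤ℓ = +-cancelˡ-≤ 2 _ _ (begin
    2 + K * (2 * σ + 5)          ≡⟨ rearrange K σ ⟩
    2 * K * σ + (5 * K + 2)      ≡⟨ cong (λ x → 2 * K * x + (5 * K + 2)) (m+[n∸m]≡n x₀≤σ) ⟨
    2 * K * (x₀ + (σ ∸ x₀)) + (5 * K + 2) ≤⟨ linear≤2^ (2 * K) (5 * K + 2) (σ ∸ x₀) ⟩
    2 ^ (x₀ + (σ ∸ x₀))          ≡⟨ cong (2 ^_) (m+[n∸m]≡n x₀≤σ) ⟩
    2 ^ σ                        ≤⟨ 2^σ≤ℓ+2 ⟩
    2 + ℓ                        ∎)
    where
    rearrange : ∀ K σ → 2 + K * (2 * σ + 5) ≡ 2 * K * σ + (5 * K + 2)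
    rearrange = solve-∀
  N = 2 + (suc ℓ + (suc σ + suc σ))
  KN≤ℓ[K+1] : K * N ≤ ℓ * (K + 1)
  KN≤ℓ[K+1] = begin
    K * N                        ≡⟨ split K ℓ σ ⟩
    K * ℓ + K * (2 * σ + 5)      ≤⟨ +-monoʳ-≤ (K * ℓ) K[2σ+5]≤ℓ ⟩
    K * ℓ + ℓ                    ≡⟨ collect K ℓ ⟩
    ℓ * (K + 1)                  ∎
    where
    split : ∀ K ℓ σ → K * (2 + (suc ℓ + (suc σ + suc σ))) ≡ K * ℓ + K * (2 * σ + 5)
    split = solve-∀
    collect : ∀ K ℓ → K * ℓ + ℓ ≡ ℓ * (K + 1)
    collect = solve-∀
  bound : ∀ n → n ≤ N * t → 2 ^ (K * n) ≤ t ^ ((K + 1) * t)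
  bound n n≤Nt = begin
    2 ^ (K * n)                  ≤⟨ ^-monoʳ-≤ 2 (*-monoʳ-≤ K n≤Nt) ⟩
    2 ^ (K * (N * t))            ≡⟨ cong (2 ^_) (*-assoc K N t) ⟨
    2 ^ (K * N * t)              ≤⟨ ^-monoʳ-≤ 2 (*-monoˡ-≤ t KN≤ℓ[K+1]) ⟩
    2 ^ (ℓ * (K + 1) * t)        ≡⟨ cong (2 ^_) (*-assoc ℓ (K + 1) t) ⟩
    2 ^ (ℓ * ((K + 1) * t))      ≡⟨ ^-*-assoc 2 ℓ ((K + 1) * t) ⟨
    (2 ^ ℓ) ^ ((K + 1) * t)      ≤⟨ ^-monoˡ-≤ ((K + 1) * t) 2^ℓ≤t ⟩
    t ^ ((K + 1) * t)            ∎

scc-lowerBound : ∀ {t n} → IsSCC t n → ∀ m → t * suc m ≤ n + suc m * 2 ^ m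
scc-lowerBound ((𝒟 , cov , refl) , _) = weight-lowerBound 𝒟 cov

corollary1 : (k : ℕ) → 1 ≤ k →
  Σ ℕ (λ T → (t : ℕ) → T ≤ t →
    Σ ℕ (λ n → IsSCC t n
      × (t ^ ((k ∸ 1) * t) ≤ 2 ^ (k * n))
      × (2 ^ (k * n) ≤ t ^ ((k + 1) * t))))
corollary1 (suc K) _ = 2 ^ lowerThreshold K + upperThreshold (suc K) , λ t T≤t →
  let r , s , t≤2^r , r<2^s , upper = power-upperBound (suc K) t (≤-trans (m≤n+m _ _) T≤t)
      𝒞 , cov , weight≡ = covering-of-weight t≤2^r r<2^s
      n , scc , n≤weight = scc-exists 𝒞 cov
  in n , scc ,
     power-lowerBound K t n (≤-trans (m≤m+n _ _) T≤t) (scc-lowerBound scc) ,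
     upper n (≤-trans n≤weight (≤-reflexive weight≡))
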